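{- $\mathrm{CHL}$ is deductively equivalent to intuitionistic logic $\mathrm{IL}$. Explicitly, let $\tau$ map $\mathrm{CHL}$-formulas to $\mathrm{IL}$-formulas and $\rho$ map $\mathrm{IL}$-formulas to $\mathrm{CHL}$-formulas, both being the identity on variables and constants and commuting with $\wedge,\vee$, with $\tau(\varphi\rightarrow\psi)=(\tau\varphi\Rightarrow\tau\psi)\wedge(\neg\tau\varphi\Rightarrow\neg\tau\psi)$ (where in $\mathrm{IL}$, $\neg\chi:=\chi\Rightarrow 0$) and $\rho(\varphi\Rightarrow\psi)=\rho\varphi\rightarrow(\rho\varphi\wedge\rho\psi)$. Then for all sets of $\mathrm{CHL}$-formulas $\Gamma\cup\{\varphi\}$: (1) $\Gamma\vdash_{\mathrm{CHL}}\varphi$ iff $\tau(\Gamma)\vdash_{\mathrm{IL}}\tau(\varphi)$; and (2) for every $\mathrm{IL}$-formula $\varphi$, $\tau(\rho(\varphi))\dashv\vdash_{\mathrm{IL}}\varphi$.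
   Context: $\mathrm{IL}$ is intuitionistic propositional logic in the language $\wedge,\vee,\Rightarrow,0,1$ (with $\Rightarrow$ intuitionistic implication). $\mathrm{CHL}$ is the logic in the language $\wedge,\vee,\rightarrow,0,1$ given by the Hilbert system below, with abbreviations (inside $\mathrm{CHL}$) $\neg\varphi:=\varphi\rightarrow 0$, $\varphi\Rightarrow\psi:=\varphi\rightarrow(\varphi\wedge\psi)$, $\varphi\Leftrightarrow\psi:=(\varphi\Rightarrow\psi)\wedge(\psi\Rightarrow\varphi)$: (CHL1) any complete set of axioms and rules for positive intuitionistic logic with implication read as $\Rightarrow$ (including modus ponens for $\Rightarrow$); (CHL2) $\neg(0\wedge\varphi)$; (CHL3) $\neg\varphi\Rightarrow(0\rightarrow\varphi)$; (CHL4) $(\varphi\rightarrow\psi)\Rightarrow(\varphi\Rightarrow\psi)$; (CHL5) $(\varphi\rightarrow\psi)\rightarrow((\psi\rightarrow\chi)\rightarrow(\varphi\rightarrow\chi))$; (CHL6) $(\varphi\rightarrow\psi)\rightarrow\neg(\varphi\rightarrow\neg\psi)$; (CHL7) the rules $\varphi\Leftrightarrow\psi\vdash(\varphi\rightarrow\chi)\Rightarrow(\psi\rightarrow\chi)$ and $\varphi\Leftrightarrow\psi\vdash(\chi\rightarrow\varphi)\Rightarrow(\chi\rightarrow\psi)$; (CHL8) $\varphi\wedge\psi\Rightarrow\varphi\wedge(\varphi\rightarrow\psi)$; (CHL9) $(\varphi\rightarrow\psi)\Rightarrow((\varphi\wedge\chi)\rightarrow(\psi\wedge\chi))$; (CHL10)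 $(\varphi\rightarrow\psi)\Rightarrow((\varphi\vee\chi)\rightarrow(\psi\vee\chi))$. $\Gamma\dashv\vdash\Delta$ means mutual derivability. -}

module Defs where

open import Data.Nat using (ℕ)
open import Data.Product using (Σ; _×_)
open import Relation.Binary.PropositionalEquality using (_≡_)

infixr 6 _∧ᴵ_ _∧ᶜ_
infixr 5 _∨ᴵ_ _∨ᶜ_
infixr 4 _⇒ᴵ_ _→ᶜ_ _⇒ᶜ_ _⇔ᶜ_
infix 2 _⊢IL_ _⊢CHL_

data IFm : Set where
  varᴵ  : ℕ → IFm
  ⊥ᴵ    : IFm
  ⊤ᴵ    : IFm
  _∧ᴵ_  : IFm → IFm → IFm
  _∨ᴵ_  : IFm → IFm → IFm
  _⇒ᴵ_  : IFm → IFm → IFm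

¬ᴵ_ : IFm → IFm
¬ᴵ χ = χ ⇒ᴵ ⊥ᴵ

data _⊢IL_ (Γ : IFm → Set) : IFm → Set where
  hyp  : ∀ {φ} → Γ φ → Γ ⊢IL φ
  axK  : ∀ {φ ψ} → Γ ⊢IL φ ⇒ᴵ (ψ ⇒ᴵ φ)
  axS  : ∀ {φ ψ χ} → Γ ⊢IL (φ ⇒ᴵ (ψ ⇒ᴵ χ)) ⇒ᴵ ((φ ⇒ᴵ ψ) ⇒ᴵ (φ ⇒ᴵ χ))
  ax∧₁ : ∀ {φ ψ} → Γ ⊢IL (φ ∧ᴵ ψ) ⇒ᴵ φ
  ax∧₂ : ∀ {φ ψ} → Γ ⊢IL (φ ∧ᴵ ψ) ⇒ᴵ ψ
  ax∧I : ∀ {φ ψ} → Γ ⊢IL φ ⇒ᴵ (ψ ⇒ᴵ (φ ∧ᴵ ψ))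
  ax∨₁ : ∀ {φ ψ} → Γ ⊢IL φ ⇒ᴵ (φ ∨ᴵ ψ)
  ax∨₂ : ∀ {φ ψ} → Γ ⊢IL ψ ⇒ᴵ (φ ∨ᴵ ψ)
  ax∨E : ∀ {φ ψ χ} → Γ ⊢IL (φ ⇒ᴵ χ) ⇒ᴵ ((ψ ⇒ᴵ χ) ⇒ᴵ ((φ ∨ᴵ ψ) ⇒ᴵ χ))
  ax⊥  : ∀ {φ} → Γ ⊢IL ⊥ᴵ ⇒ᴵ φ
  ax⊤  : Γ ⊢IL ⊤ᴵ
  mp   : ∀ {φ ψ} → Γ ⊢IL φ → Γ ⊢IL φ ⇒ᴵ ψ → Γ ⊢IL ψ

data CFm : Set where
  varᶜ  : ℕ → CFm
  ⊥ᶜ    : CFm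
  ⊤ᶜ    : CFm
  _∧ᶜ_  : CFm → CFm → CFm
  _∨ᶜ_  : CFm → CFm → CFm
  _→ᶜ_  : CFm → CFm → CFm

¬ᶜ_ : CFm → CFm
¬ᶜ φ = φ →ᶜ ⊥ᶜ

_⇒ᶜ_ : CFm → CFm → CFm
φ ⇒ᶜ ψ = φ →ᶜ (φ ∧ᶜ ψ)

_⇔ᶜ_ : CFm → CFm → CFm
φ ⇔ᶜ ψ = (φ ⇒ᶜ ψ) ∧ᶜ (ψ ⇒ᶜ φ)

data _⊢CHL_ (Γ : CFm → Set) : CFm → Set where
  hyp   : ∀ {φ} → Γ φ → Γ ⊢CHL φ
  axK   : ∀ {φ ψ} → Γ ⊢CHL φ ⇒ᶜ (ψ ⇒ᶜ φ)
  axS   : ∀ {φ ψ χ} → Γ ⊢CHL (φ ⇒ᶜ (ψ ⇒ᶜ χ)) ⇒ᶜ ((φ ⇒ᶜ ψ) ⇒ᶜ (φ ⇒ᶜ χ))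
  ax∧₁  : ∀ {φ ψ} → Γ ⊢CHL (φ ∧ᶜ ψ) ⇒ᶜ φ
  ax∧₂  : ∀ {φ ψ} → Γ ⊢CHL (φ ∧ᶜ ψ) ⇒ᶜ ψ
  ax∧I  : ∀ {φ ψ} → Γ ⊢CHL φ ⇒ᶜ (ψ ⇒ᶜ (φ ∧ᶜ ψ))
  ax∨₁  : ∀ {φ ψ} → Γ ⊢CHL φ ⇒ᶜ (φ ∨ᶜ ψ)
  ax∨₂  : ∀ {φ ψ} → Γ ⊢CHL ψ ⇒ᶜ (φ ∨ᶜ ψ)
  ax∨E  : ∀ {φ ψ χ} → Γ ⊢CHL (φ ⇒ᶜ χ) ⇒ᶜ ((ψ ⇒ᶜ χ) ⇒ᶜ ((φ ∨ᶜ ψ) ⇒ᶜ χ))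
  ax⊤   : Γ ⊢CHL ⊤ᶜ
  mp    : ∀ {φ ψ} → Γ ⊢CHL φ → Γ ⊢CHL φ ⇒ᶜ ψ → Γ ⊢CHL ψ
  chl2  : ∀ {φ} → Γ ⊢CHL ¬ᶜ (⊥ᶜ ∧ᶜ φ)
  chl3  : ∀ {φ} → Γ ⊢CHL (¬ᶜ φ) ⇒ᶜ (⊥ᶜ →ᶜ φ)
  chl4  : ∀ {φ ψ} → Γ ⊢CHL (φ →ᶜ ψ) ⇒ᶜ (φ ⇒ᶜ ψ)
  chl5  : ∀ {φ ψ χ} → Γ ⊢CHL (φ →ᶜ ψ) →ᶜ ((ψ →ᶜ χ) →ᶜ (φ →ᶜ χ))
  chl6  : ∀ {φ ψ} → Γ ⊢CHL (φ →ᶜ ψ) →ᶜ (¬ᶜ (φ →ᶜ (¬ᶜ ψ)))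
  chl7ˡ : ∀ {φ ψ χ} → Γ ⊢CHL φ ⇔ᶜ ψ → Γ ⊢CHL (φ →ᶜ χ) ⇒ᶜ (ψ →ᶜ χ)
  chl7ʳ : ∀ {φ ψ χ} → Γ ⊢CHL φ ⇔ᶜ ψ → Γ ⊢CHL (χ →ᶜ φ) ⇒ᶜ (χ →ᶜ ψ)
  chl8  : ∀ {φ ψ} → Γ ⊢CHL (φ ∧ᶜ ψ) ⇒ᶜ (φ ∧ᶜ (φ →ᶜ ψ))
  chl9  : ∀ {φ ψ χ} → Γ ⊢CHL (φ →ᶜ ψ) ⇒ᶜ ((φ ∧ᶜ χ) →ᶜ (ψ ∧ᶜ χ))
  chl10 : ∀ {φ ψ χ} → Γ ⊢CHL (φ →ᶜ ψ) ⇒ᶜ ((φ ∨ᶜ χ) →ᶜ (ψ ∨ᶜ χ))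

τ : CFm → IFm
τ (varᶜ n) = varᴵ n
τ ⊥ᶜ = ⊥ᴵ
τ ⊤ᶜ = ⊤ᴵ
τ (φ ∧ᶜ ψ) = τ φ ∧ᴵ τ ψ
τ (φ ∨ᶜ ψ) = τ φ ∨ᴵ τ ψ
τ (φ →ᶜ ψ) = (τ φ ⇒ᴵ τ ψ) ∧ᴵ ((¬ᴵ τ φ) ⇒ᴵ (¬ᴵ τ ψ))

ρ : IFm → CFm
ρ (varᴵ n) = varᶜ n
ρ ⊥ᴵ = ⊥ᶜ
ρ ⊤ᴵ = ⊤ᶜ
ρ (φ ∧ᴵ ψ) = ρ φ ∧ᶜ ρ ψ
ρ (φ ∨ᴵ ψ) = ρ φ ∨ᶜ ρ ψ
ρ (φ ⇒ᴵ ψ) = ρ φ →ᶜ (ρ φ ∧ᶜ ρ ψ)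

τ[_] : (CFm → Set) → IFm → Set
τ[ Γ ] ψ = Σ CFm (λ φ → Γ φ × τ φ ≡ ψ)

｛_｝ : IFm → IFm → Set
｛ φ ｝ ψ = ψ ≡ φ

module Submission where

-- Write A ↝ B for (A ⇒ B) ∧ (¬A ⇒ ¬B), so that τ (φ →ᶜ ψ) = τ φ ↝ τ ψ and
-- τ (φ ⇒ᶜ ψ) = τ φ ↝ (τ φ ∧ τ ψ). With these readings every axiom and rule of
-- CHL is intuitionistically valid, so τ preserves derivability. Conversely ρ
-- sends each IL axiom to the CHL axiom of the same shape, as
-- ρ (φ ⇒ ψ) = ρ φ ⇒ᶜ ρ ψ, and inside CHL the formula φ →ᶜ ψ is equivalent to
-- (φ ⇒ᶜ ψ) ∧ (∼ φ ⇒ᶜ ∼ ψ) with ∼ φ = φ ⇒ᶜ 0; hence φ and ρ (τ φ) are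
-- CHL-equivalent, which reflects IL-derivability of τ-images back to CHL.
-- Finally τ (ρ (φ ⇒ ψ)) has the shape A ↝ (A ∧ B), which IL proves equivalent
-- to A ⇒ B. With ⇒ᶜ as implication CHL extends positive logic with ex falso,
-- so the same intuitionistic reasoning is available inside CHL.

open import Defs
open import Data.Product using (_×_; _,_)
open import Data.List using (List; []; _∷_)
open import Data.List.Membership.Propositional using (_∈_)
open import Data.List.Relation.Unary.Any using (here; there)
open import Function.Bundles using (_⇔_; mk⇔)
open import Relation.Binary.PropositionalEquality using (refl)

record HilbertSystem : Set₁ where
  infixr 6 _∧_
  infixr 5 _∨_
  infixr 4 _⊃_
  infix 2 _⊢_
  field
    Form : Set
    _⊢_ : (Form → Set) → Form → Set
    _⊃_ _∧_ _∨_ : Form → Form → Form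
    ⊥ ⊤ : Form
    ⊃-K : ∀ {Γ A B} → Γ ⊢ A ⊃ B ⊃ A
    ⊃-S : ∀ {Γ A B C} → Γ ⊢ (A ⊃ B ⊃ C) ⊃ (A ⊃ B) ⊃ A ⊃ C
    ∧-proj₁ : ∀ {Γ A B} → Γ ⊢ A ∧ B ⊃ A
    ∧-proj₂ : ∀ {Γ A B} → Γ ⊢ A ∧ B ⊃ B
    ∧-pair : ∀ {Γ A B} → Γ ⊢ A ⊃ B ⊃ A ∧ B
    ∨-inj₁ : ∀ {Γ A B} → Γ ⊢ A ⊃ A ∨ B
    ∨-inj₂ : ∀ {Γ A B} → Γ ⊢ B ⊃ A ∨ B
    ∨-case : ∀ {Γ A B C} → Γ ⊢ (A ⊃ C) ⊃ (B ⊃ C) ⊃ A ∨ B ⊃ C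
    ⊥-elim : ∀ {Γ A} → Γ ⊢ ⊥ ⊃ A
    ⊤-intro : ∀ {Γ} → Γ ⊢ ⊤
    modus-ponens : ∀ {Γ A B} → Γ ⊢ A → Γ ⊢ A ⊃ B → Γ ⊢ B

module Deduction (H : HilbertSystem) where
  open HilbertSystem H

  infix 2 _⊩_
  infixr 4 _↝_ _⇛_
  infix 3 _⟺_

  Theorem : Form → Set₁
  Theorem A = ∀ {Γ} → Γ ⊢ A

  data _⊩_ (Δ : List Form) : Form → Set₁ where
    var : ∀ {A} → A ∈ Δ → Δ ⊩ A
    thm : ∀ {A} → Theorem A → Δ ⊩ A
    ⊃E  : ∀ {A B} → Δ ⊩ A ⊃ B → Δ ⊩ A → Δ ⊩ B

  private variable
    Δ : List Form
    A A′ B B′ C : Form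

  #0 : A ∷ Δ ⊩ A
  #0 = var (here refl)

  #1 : ∀ {A₀} → A₀ ∷ A ∷ Δ ⊩ A
  #1 = var (there (here refl))

  #2 : ∀ {A₀ A₁} → A₀ ∷ A₁ ∷ A ∷ Δ ⊩ A
  #2 = var (there (there (here refl)))

  #3 : ∀ {A₀ A₁ A₂} → A₀ ∷ A₁ ∷ A₂ ∷ A ∷ Δ ⊩ A
  #3 = var (there (there (there (here refl))))

  weaken : Δ ⊩ B → A ∷ Δ ⊩ B
  weaken (var x) = var (there x)
  weaken (thm t) = thm t
  weaken (⊃E d e) = ⊃E (weaken d) (weaken e)

  ⊃-refl : Δ ⊩ A ⊃ A
  ⊃-refl {A = A} = ⊃E (⊃E (thm ⊃-S) (thm ⊃-K)) (thm (⊃-K {B = A}))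

  ⊃I : A ∷ Δ ⊩ B → Δ ⊩ A ⊃ B
  ⊃I (var (here refl)) = ⊃-refl
  ⊃I (var (there x)) = ⊃E (thm ⊃-K) (var x)
  ⊃I (thm t) = ⊃E (thm ⊃-K) (thm t)
  ⊃I (⊃E d e) = ⊃E (⊃E (thm ⊃-S) (⊃I d)) (⊃I e)

  close : [] ⊩ A → Theorem A
  close (var ())
  close (thm t) = t
  close (⊃E d e) = modus-ponens (close e) (close d)

  ∧I : Δ ⊩ A → Δ ⊩ B → Δ ⊩ A ∧ B
  ∧I a b = ⊃E (⊃E (thm ∧-pair) a) b

  ∧E₁ : Δ ⊩ A ∧ B → Δ ⊩ A
  ∧E₁ = ⊃E (thm ∧-proj₁)

  ∧E₂ : Δ ⊩ A ∧ B → Δ ⊩ B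
  ∧E₂ = ⊃E (thm ∧-proj₂)

  ∨I₁ : Δ ⊩ A → Δ ⊩ A ∨ B
  ∨I₁ = ⊃E (thm ∨-inj₁)

  ∨I₂ : Δ ⊩ B → Δ ⊩ A ∨ B
  ∨I₂ = ⊃E (thm ∨-inj₂)

  ∨E : Δ ⊩ A ∨ B → A ∷ Δ ⊩ C → B ∷ Δ ⊩ C → Δ ⊩ C
  ∨E d e₁ e₂ = ⊃E (⊃E (⊃E (thm ∨-case) (⊃I e₁)) (⊃I e₂)) d

  ⊥E : Δ ⊩ ⊥ → Δ ⊩ A
  ⊥E = ⊃E (thm ⊥-elim)

  ⊤I : Δ ⊩ ⊤
  ⊤I = thm ⊤-intro

  _⟺_ : Form → Form → Form
  A ⟺ B = (A ⊃ B) ∧ (B ⊃ A)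

  ⟺-intro : A ∷ [] ⊩ B → B ∷ [] ⊩ A → Theorem (A ⟺ B)
  ⟺-intro d e = close (∧I (⊃I d) (⊃I e))

  ⟺-to : Theorem (A ⟺ B) → Δ ⊩ A → Δ ⊩ B
  ⟺-to e = ⊃E (∧E₁ (thm e))

  ⟺-from : Theorem (A ⟺ B) → Δ ⊩ B → Δ ⊩ A
  ⟺-from e = ⊃E (∧E₂ (thm e))

  transport : ∀ {Γ} → Theorem (A ⟺ B) → Γ ⊢ A → Γ ⊢ B
  transport e a = modus-ponens a (modus-ponens e ∧-proj₁)

  transport⁻ : ∀ {Γ} → Theorem (A ⟺ B) → Γ ⊢ B → Γ ⊢ A
  transport⁻ e b = modus-ponens b (modus-ponens e ∧-proj₂)

  ⟺-refl : Theorem (A ⟺ A)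
  ⟺-refl = ⟺-intro #0 #0

  ⟺-sym : Theorem (A ⟺ B) → Theorem (B ⟺ A)
  ⟺-sym e = ⟺-intro (⟺-from e #0) (⟺-to e #0)

  ⟺-trans : Theorem (A ⟺ B) → Theorem (B ⟺ C) → Theorem (A ⟺ C)
  ⟺-trans e f = ⟺-intro (⟺-to f (⟺-to e #0)) (⟺-from e (⟺-from f #0))

  ∧-cong : Theorem (A ⟺ A′) → Theorem (B ⟺ B′) → Theorem (A ∧ B ⟺ A′ ∧ B′)
  ∧-cong e f = ⟺-intro (∧I (⟺-to e (∧E₁ #0)) (⟺-to f (∧E₂ #0)))
                       (∧I (⟺-from e (∧E₁ #0)) (⟺-from f (∧E₂ #0)))

  ∨-cong : Theorem (A ⟺ A′) → Theorem (B ⟺ B′) → Theorem (A ∨ B ⟺ A′ ∨ B′)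
  ∨-cong e f = ⟺-intro (∨E #0 (∨I₁ (⟺-to e #0)) (∨I₂ (⟺-to f #0)))
                       (∨E #0 (∨I₁ (⟺-from e #0)) (∨I₂ (⟺-from f #0)))

  ⊃-cong : Theorem (A ⟺ A′) → Theorem (B ⟺ B′) → Theorem ((A ⊃ B) ⟺ (A′ ⊃ B′))
  ⊃-cong e f = ⟺-intro (⊃I (⟺-to f (⊃E #1 (⟺-from e #0))))
                       (⊃I (⟺-from f (⊃E #1 (⟺-to e #0))))

  ∧-comm : Theorem (A ∧ B ⟺ B ∧ A)
  ∧-comm = ⟺-intro (∧I (∧E₂ #0) (∧E₁ #0)) (∧I (∧E₂ #0) (∧E₁ #0))

  ⊤-∧-identityˡ : Theorem (⊤ ∧ A ⟺ A)
  ⊤-∧-identityˡ = ⟺-intro (∧E₂ #0) (∧I ⊤I #0)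

  ∼_ : Form → Form
  ∼ A = A ⊃ ⊥

  ∼⊥ : Δ ⊩ ∼ ⊥
  ∼⊥ = ⊃I #0

  -- Refutations may split on A ∨ ∼ A; the negative halves of the ↝-laws below
  -- are checked this way, by truth tables built from ↝-tt, ↝-ff, ↝-tf, ↝-ft.
  by-cases : A ∷ Δ ⊩ ⊥ → ∼ A ∷ Δ ⊩ ⊥ → Δ ⊩ ⊥
  by-cases d e = ⊃E (⊃I e) (⊃I d)

  _↝_ : Form → Form → Form
  A ↝ B = (A ⊃ B) ∧ (∼ A ⊃ ∼ B)

  ↝I : A ∷ Δ ⊩ B → ∼ A ∷ Δ ⊩ ∼ B → Δ ⊩ A ↝ B
  ↝I d e = ∧I (⊃I d) (⊃I e)

  ↝E : Δ ⊩ A ↝ B → Δ ⊩ A → Δ ⊩ B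
  ↝E f = ⊃E (∧E₁ f)

  ↝E∼ : Δ ⊩ A ↝ B → Δ ⊩ ∼ A → Δ ⊩ ∼ B
  ↝E∼ f = ⊃E (∧E₂ f)

  ↝-cong : Theorem (A ⟺ A′) → Theorem (B ⟺ B′) → Theorem (A ↝ B ⟺ A′ ↝ B′)
  ↝-cong e f = ∧-cong (⊃-cong e f) (⊃-cong (⊃-cong e ⟺-refl) (⊃-cong f ⟺-refl))

  ↝-tt : Δ ⊩ A → Δ ⊩ B → Δ ⊩ A ↝ B
  ↝-tt a b = ↝I (weaken b) (⊃I (⊃E #1 (weaken (weaken a))))

  ↝-ff : Δ ⊩ ∼ A → Δ ⊩ ∼ B → Δ ⊩ A ↝ B
  ↝-ff na nb = ↝I (⊥E (⊃E (weaken na) #0)) (weaken nb)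

  ↝-tf : Δ ⊩ A → Δ ⊩ ∼ B → Δ ⊩ ∼ (A ↝ B)
  ↝-tf a nb = ⊃I (⊃E (weaken nb) (↝E #0 (weaken a)))

  ↝-ft : Δ ⊩ ∼ A → Δ ⊩ B → Δ ⊩ ∼ (A ↝ B)
  ↝-ft na b = ⊃I (⊃E (↝E∼ #0 (weaken na)) (weaken b))

  _⇛_ : Form → Form → Form
  A ⇛ B = A ↝ A ∧ B

  ⇛I : A ∷ Δ ⊩ B → Δ ⊩ A ⇛ B
  ⇛I d = ↝I (∧I #0 d) (⊃I (⊃E #1 (∧E₁ #0)))

  ⇛E : Δ ⊩ A ⇛ B → Δ ⊩ A → Δ ⊩ B
  ⇛E f a = ∧E₂ (↝E f a)

  ⇛-modus-ponens : ∀ {Γ} → Γ ⊢ A → Γ ⊢ A ⇛ B → Γ ⊢ B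
  ⇛-modus-ponens a f = modus-ponens (modus-ponens a (modus-ponens f ∧-proj₁)) ∧-proj₂

  ⇛⟺⊃ : Theorem ((A ⇛ B) ⟺ (A ⊃ B))
  ⇛⟺⊃ = ⟺-intro (⊃I (⇛E #1 #0)) (⇛I (⊃E #1 #0))

  ⇛-K : Theorem (A ⇛ B ⇛ A)
  ⇛-K = close (⇛I (⇛I #1))

  ⇛-S : Theorem ((A ⇛ B ⇛ C) ⇛ (A ⇛ B) ⇛ A ⇛ C)
  ⇛-S = close (⇛I (⇛I (⇛I (⇛E (⇛E #2 #0) (⇛E #1 #0)))))

  ⇛-proj₁ : Theorem (A ∧ B ⇛ A)
  ⇛-proj₁ = close (⇛I (∧E₁ #0))

  ⇛-proj₂ : Theorem (A ∧ B ⇛ B)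
  ⇛-proj₂ = close (⇛I (∧E₂ #0))

  ⇛-pair : Theorem (A ⇛ B ⇛ A ∧ B)
  ⇛-pair = close (⇛I (⇛I (∧I #1 #0)))

  ⇛-inj₁ : Theorem (A ⇛ A ∨ B)
  ⇛-inj₁ = close (⇛I (∨I₁ #0))

  ⇛-inj₂ : Theorem (B ⇛ A ∨ B)
  ⇛-inj₂ = close (⇛I (∨I₂ #0))

  ⇛-case : Theorem ((A ⇛ C) ⇛ (B ⇛ C) ⇛ A ∨ B ⇛ C)
  ⇛-case = close (⇛I (⇛I (⇛I (∨E #0 (⇛E #3 #0) (⇛E #2 #0)))))

  ↝-chl2 : Theorem (⊥ ∧ A ↝ ⊥)
  ↝-chl2 = close (↝-ff (⊃I (∧E₁ #0)) ∼⊥)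

  ↝-chl3 : Theorem ((A ↝ ⊥) ⇛ (⊥ ↝ A))
  ↝-chl3 = close (⇛I (↝I (⊥E #0) (⊃I (↝E #2 #0))))

  ↝-chl4 : Theorem ((A ↝ B) ⇛ (A ⇛ B))
  ↝-chl4 = close (⇛I (⇛I (↝E #1 #0)))

  ↝-chl5 : Theorem ((A ↝ B) ↝ (B ↝ C) ↝ (A ↝ C))
  ↝-chl5 {A = A} {B} {C} =
    close (↝I (↝I (↝I (↝E #1 (↝E #2 #0)) (↝E∼ #1 (↝E∼ #2 #0)))
                  (⊃I (by-cases {A = A}
                        (⊃E #2 (↝-tt (↝E #3 #0) (↝E #1 #0)))
                        (⊃E #2 (↝-ff (↝E∼ #3 #0) (↝E∼ #1 #0))))))
              (⊃I (by-cases {A = A}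
                    (by-cases {A = B}
                      (⊃E #3 (↝-tt #1 #0))
                      (by-cases {A = C}
                        (⊃E (↝E∼ #3 (↝-ft #1 #0)) (↝-tt #2 #0))
                        (⊃E (↝-tf #2 #0) (↝E #3 (↝-ff #1 #0)))))
                    (by-cases {A = B}
                      (by-cases {A = C}
                        (⊃E (↝-ft #2 #0) (↝E #3 (↝-tt #1 #0)))
                        (⊃E (↝E∼ #3 (↝-tf #1 #0)) (↝-ff #2 #0)))
                      (⊃E #3 (↝-ff #1 #0))))))

  ↝-chl6 : Theorem ((A ↝ B) ↝ (A ↝ (B ↝ ⊥)) ↝ ⊥)
  ↝-chl6 {A = A} {B} =
    close (↝I (↝-ff (⊃I (by-cases {A = A}
                          (↝E (↝E #1 #0) (↝E #2 #0))
                          (⊃E (↝E∼ #1 #0) (↝-ff (↝E∼ #2 #0) ∼⊥))))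
                    ∼⊥)
              (⊃I (by-cases {A = A}
                    (by-cases {A = B}
                      (⊃E #3 (↝-tt #1 #0))
                      (↝E #2 (↝-tt #1 (↝-ff #0 ∼⊥))))
                    (by-cases {A = B}
                      (↝E #2 (↝-ff #1 (↝-tf #0 ∼⊥)))
                      (⊃E #3 (↝-ff #1 #0))))))

  ↝-chl7ˡ : Theorem ((A ⇛ B) ∧ (B ⇛ A) ⇛ (A ↝ C) ⇛ (B ↝ C))
  ↝-chl7ˡ = close (⇛I (⇛I (↝I (↝E #1 (⇛E (∧E₂ #2) #0))
                              (↝E∼ #1 (⊃I (⊃E #1 (⇛E (∧E₁ #3) #0)))))))

  ↝-chl7ʳ : Theorem ((A ⇛ B) ∧ (B ⇛ A) ⇛ (C ↝ A) ⇛ (C ↝ B))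
  ↝-chl7ʳ = close (⇛I (⇛I (↝I (⇛E (∧E₁ #2) (↝E #1 #0))
                              (⊃I (⊃E (↝E∼ #2 #1) (⇛E (∧E₂ #3) #0))))))

  ↝-chl8 : Theorem (A ∧ B ⇛ A ∧ (A ↝ B))
  ↝-chl8 = close (⇛I (∧I (∧E₁ #0) (↝-tt (∧E₁ #0) (∧E₂ #0))))

  ↝-chl9 : Theorem ((A ↝ B) ⇛ (A ∧ C ↝ B ∧ C))
  ↝-chl9 {A = A} =
    close (⇛I (↝I (∧I (↝E #1 (∧E₁ #0)) (∧E₂ #0))
                  (⊃I (by-cases {A = A}
                        (⊃E #2 (∧I #0 (∧E₂ #1)))
                        (⊃E (↝E∼ #3 #0) (∧E₁ #1))))))

  ↝-chl10 : Theorem ((A ↝ B) ⇛ (A ∨ C ↝ B ∨ C))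
  ↝-chl10 =
    close (⇛I (↝I (∨E #0 (∨I₁ (↝E #2 #0)) (∨I₂ #0))
                  (⊃I (∨E #0
                        (⊃E (↝E∼ #3 (⊃I (⊃E #3 (∨I₁ #0)))) #0)
                        (⊃E #2 (∨I₂ #0))))))

IL-system : HilbertSystem
IL-system = record
  { Form = IFm ; _⊢_ = _⊢IL_ ; _⊃_ = _⇒ᴵ_ ; _∧_ = _∧ᴵ_ ; _∨_ = _∨ᴵ_ ; ⊥ = ⊥ᴵ ; ⊤ = ⊤ᴵ
  ; ⊃-K = axK ; ⊃-S = axS ; ∧-proj₁ = ax∧₁ ; ∧-proj₂ = ax∧₂ ; ∧-pair = ax∧I
  ; ∨-inj₁ = ax∨₁ ; ∨-inj₂ = ax∨₂ ; ∨-case = ax∨E ; ⊥-elim = ax⊥ ; ⊤-intro = ax⊤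
  ; modus-ponens = mp
  }

module IL = Deduction IL-system

τ-preserves-⊢ : ∀ {Γ φ} → Γ ⊢CHL φ → τ[ Γ ] ⊢IL τ φ
τ-preserves-⊢ (hyp γ) = hyp (_ , γ , refl)
τ-preserves-⊢ axK = IL.⇛-K
τ-preserves-⊢ axS = IL.⇛-S
τ-preserves-⊢ ax∧₁ = IL.⇛-proj₁
τ-preserves-⊢ ax∧₂ = IL.⇛-proj₂
τ-preserves-⊢ ax∧I = IL.⇛-pair
τ-preserves-⊢ ax∨₁ = IL.⇛-inj₁
τ-preserves-⊢ ax∨₂ = IL.⇛-inj₂
τ-preserves-⊢ ax∨E = IL.⇛-case
τ-preserves-⊢ ax⊤ = ax⊤
τ-preserves-⊢ (mp d e) = IL.⇛-modus-ponens (τ-preserves-⊢ d) (τ-preserves-⊢ e)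
τ-preserves-⊢ chl2 = IL.↝-chl2
τ-preserves-⊢ chl3 = IL.↝-chl3
τ-preserves-⊢ chl4 = IL.↝-chl4
τ-preserves-⊢ chl5 = IL.↝-chl5
τ-preserves-⊢ chl6 = IL.↝-chl6
τ-preserves-⊢ (chl7ˡ d) = IL.⇛-modus-ponens (τ-preserves-⊢ d) IL.↝-chl7ˡ
τ-preserves-⊢ (chl7ʳ d) = IL.⇛-modus-ponens (τ-preserves-⊢ d) IL.↝-chl7ʳ
τ-preserves-⊢ chl8 = IL.↝-chl8
τ-preserves-⊢ chl9 = IL.↝-chl9
τ-preserves-⊢ chl10 = IL.↝-chl10

τρ⟺ : ∀ φ → IL.Theorem (τ (ρ φ) IL.⟺ φ)
τρ⟺ (varᴵ n) = IL.⟺-refl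
τρ⟺ ⊥ᴵ = IL.⟺-refl
τρ⟺ ⊤ᴵ = IL.⟺-refl
τρ⟺ (φ ∧ᴵ ψ) = IL.∧-cong (τρ⟺ φ) (τρ⟺ ψ)
τρ⟺ (φ ∨ᴵ ψ) = IL.∨-cong (τρ⟺ φ) (τρ⟺ ψ)
τρ⟺ (φ ⇒ᴵ ψ) = IL.⟺-trans IL.⇛⟺⊃ (IL.⊃-cong (τρ⟺ φ) (τρ⟺ ψ))

-- ⊥ᶜ ⇒ᶜ A unfolds to ⊥ᶜ →ᶜ (⊥ᶜ ∧ᶜ A): CHL3 for ⊥ᶜ ∧ᶜ A, fed with CHL2.
chl-⊥-elim : ∀ {Γ A} → Γ ⊢CHL ⊥ᶜ ⇒ᶜ A
chl-⊥-elim = mp chl2 chl3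

CHL-system : HilbertSystem
CHL-system = record
  { Form = CFm ; _⊢_ = _⊢CHL_ ; _⊃_ = _⇒ᶜ_ ; _∧_ = _∧ᶜ_ ; _∨_ = _∨ᶜ_ ; ⊥ = ⊥ᶜ ; ⊤ = ⊤ᶜ
  ; ⊃-K = axK ; ⊃-S = axS ; ∧-proj₁ = ax∧₁ ; ∧-proj₂ = ax∧₂ ; ∧-pair = ax∧I
  ; ∨-inj₁ = ax∨₁ ; ∨-inj₂ = ax∨₂ ; ∨-case = ax∨E ; ⊥-elim = chl-⊥-elim ; ⊤-intro = ax⊤
  ; modus-ponens = mp
  }

module CHL = Deduction CHL-system

module _ where
  open CHL

  private variable
    Δ : List CFm
    A B C : CFm

  →-mp : Δ ⊩ A →ᶜ B → Δ ⊩ A → Δ ⊩ B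
  →-mp f = ⊃E (⊃E (thm chl4) f)

  →-trans : Δ ⊩ A →ᶜ B → Δ ⊩ B →ᶜ C → Δ ⊩ A →ᶜ C
  →-trans f g = →-mp (→-mp (thm chl5) f) g

  →-congˡ : Theorem (A ⟺ B) → Δ ⊩ A →ᶜ C → Δ ⊩ B →ᶜ C
  →-congˡ e = ⊃E (thm (chl7ˡ e))

  →-congʳ : Theorem (A ⟺ B) → Δ ⊩ C →ᶜ A → Δ ⊩ C →ᶜ B
  →-congʳ e = ⊃E (thm (chl7ʳ e))

  ∧⇒→ᶜ : Δ ⊩ A ∧ᶜ B → Δ ⊩ A →ᶜ B
  ∧⇒→ᶜ d = ∧E₂ (⊃E (thm chl8) d)

  ¬ᶜ⇒∼ : Δ ⊩ ¬ᶜ A → Δ ⊩ ∼ A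
  ¬ᶜ⇒∼ = ⊃E (thm chl4)

  ∼⇒¬ᶜ : Δ ⊩ ∼ A → Δ ⊩ ¬ᶜ A
  ∼⇒¬ᶜ h = →-trans h (→-congˡ ∧-comm (thm chl2))

  ⊤→ᶜ⟺ : Theorem ((⊤ᶜ →ᶜ A) ⟺ A)
  ⊤→ᶜ⟺ = ⟺-intro (→-mp #0 ⊤I) (∧⇒→ᶜ (∧I ⊤I #0))

  →ᶜ¬ᶜ¬ᶜ : Theorem (A →ᶜ ¬ᶜ ¬ᶜ A)
  →ᶜ¬ᶜ¬ᶜ {A = A} = close (→-congʳ ¬ᶜ⊤→ᶜ⟺ (→-congˡ ⊤→ᶜ⟺ (thm chl6)))
    where
    ¬ᶜ⊤→ᶜ⟺ : Theorem (¬ᶜ (⊤ᶜ →ᶜ ¬ᶜ A) ⟺ ¬ᶜ ¬ᶜ A)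
    ¬ᶜ⊤→ᶜ⟺ = ⟺-intro (→-congˡ ⊤→ᶜ⟺ #0) (→-congˡ (⟺-sym ⊤→ᶜ⟺) #0)

  →ᶜ-adjoinˡ : Δ ⊩ C → Δ ⊩ A →ᶜ C ∧ᶜ A
  →ᶜ-adjoinˡ c = →-congˡ ⊤-∧-identityˡ (⊃E (thm chl9) (∧⇒→ᶜ (∧I ⊤I c)))

  →ᶜ-dischargeˡ : Δ ⊩ C → Δ ⊩ C ∧ᶜ A →ᶜ A
  →ᶜ-dischargeˡ c = →-congʳ ⊤-∧-identityˡ (⊃E (thm chl9) (∧⇒→ᶜ (∧I c ⊤I)))

  -- Under h, A is equivalent to (A ↝ B) ∧ᶜ A and thus to A ∧ᶜ B, which by CHL9
  -- implies ¬ᶜ ¬ᶜ A ∧ᶜ B; that is equivalent to (A ↝ B) ∧ᶜ B and thus to B.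
  ↝⇒→ᶜ : Δ ⊩ A ↝ B → Δ ⊩ A →ᶜ B
  ↝⇒→ᶜ {A = A} {B} h = →-trans (→ᶜ-adjoinˡ h) (→-trans (thm shift) (→ᶜ-dischargeˡ h))
    where
    shift : Theorem ((A ↝ B) ∧ᶜ A →ᶜ (A ↝ B) ∧ᶜ B)
    shift = close (→-congˡ ∧⟺↝∧ (→-congʳ ¬ᶜ¬ᶜ∧⟺↝∧ (⊃E (thm chl9) (thm →ᶜ¬ᶜ¬ᶜ))))
      where
      ∧⟺↝∧ : Theorem (A ∧ᶜ B ⟺ (A ↝ B) ∧ᶜ A)
      ∧⟺↝∧ = ⟺-intro (∧I (↝-tt (∧E₁ #0) (∧E₂ #0)) (∧E₁ #0))
                      (∧I (∧E₂ #0) (↝E (∧E₁ #0) (∧E₂ #0)))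
      ¬ᶜ¬ᶜ∧⟺↝∧ : Theorem (¬ᶜ ¬ᶜ A ∧ᶜ B ⟺ (A ↝ B) ∧ᶜ B)
      ¬ᶜ¬ᶜ∧⟺↝∧ = ⟺-intro (∧I (↝I (∧E₂ #1) (⊥E (→-mp (∧E₁ #1) (∼⇒¬ᶜ #0)))) (∧E₂ #0))
                          (∧I (∼⇒¬ᶜ (⊃I (⊃E (↝E∼ (∧E₁ #1) (¬ᶜ⇒∼ #0)) (∧E₂ #1)))) (∧E₂ #0))

  →ᶜ⇒↝ : Δ ⊩ A →ᶜ B → Δ ⊩ A ↝ B
  →ᶜ⇒↝ {Δ = Δ} {A} {B} f = ∧I (⊃E (thm chl4) f) (⊃I (⊃I refuted))
    where
    -- CHL6 gives ¬ᶜ (A →ᶜ ¬ᶜ B), while ∼ A and B give A →ᶜ ⊥ᶜ →ᶜ ¬ᶜ B by CHL3.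
    refuted : B ∷ ∼ A ∷ Δ ⊩ ⊥ᶜ
    refuted = →-mp (→-mp (thm chl6) (weaken (weaken f)))
                   (→-trans (∼⇒¬ᶜ #1) (⊃E (thm chl3) (→-mp (thm →ᶜ¬ᶜ¬ᶜ) #0)))

  →ᶜ⟺↝ : Theorem ((A →ᶜ B) ⟺ (A ↝ B))
  →ᶜ⟺↝ = ⟺-intro (→ᶜ⇒↝ #0) (↝⇒→ᶜ #0)

  ρτ⟺ : ∀ φ → Theorem (φ ⟺ ρ (τ φ))
  ρτ⟺ (varᶜ n) = ⟺-refl
  ρτ⟺ ⊥ᶜ = ⟺-refl
  ρτ⟺ ⊤ᶜ = ⟺-refl
  ρτ⟺ (φ ∧ᶜ ψ) = ∧-cong (ρτ⟺ φ) (ρτ⟺ ψ)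
  ρτ⟺ (φ ∨ᶜ ψ) = ∨-cong (ρτ⟺ φ) (ρτ⟺ ψ)
  ρτ⟺ (φ →ᶜ ψ) = ⟺-trans →ᶜ⟺↝ (↝-cong (ρτ⟺ φ) (ρτ⟺ ψ))

ρ-preserves-⊢ : ∀ {Γ ψ} → τ[ Γ ] ⊢IL ψ → Γ ⊢CHL ρ ψ
ρ-preserves-⊢ (hyp (φ , γ , refl)) = CHL.transport (ρτ⟺ φ) (hyp γ)
ρ-preserves-⊢ axK = axK
ρ-preserves-⊢ axS = axS
ρ-preserves-⊢ ax∧₁ = ax∧₁
ρ-preserves-⊢ ax∧₂ = ax∧₂
ρ-preserves-⊢ ax∧I = ax∧I
ρ-preserves-⊢ ax∨₁ = ax∨₁
ρ-preserves-⊢ ax∨₂ = ax∨₂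
ρ-preserves-⊢ ax∨E = ax∨E
ρ-preserves-⊢ ax⊥ = chl-⊥-elim
ρ-preserves-⊢ ax⊤ = ax⊤
ρ-preserves-⊢ (mp d e) = mp (ρ-preserves-⊢ d) (ρ-preserves-⊢ e)

theorem4p3 : ((Γ : CFm → Set) (φ : CFm) → (Γ ⊢CHL φ) ⇔ (τ[ Γ ] ⊢IL τ φ))
           × ((φ : IFm) → (｛ τ (ρ φ) ｝ ⊢IL φ) × (｛ φ ｝ ⊢IL τ (ρ φ)))
theorem4p3 =
  (λ Γ φ → mk⇔ τ-preserves-⊢ (λ d → CHL.transport⁻ (ρτ⟺ φ) (ρ-preserves-⊢ d))) ,
  (λ φ → IL.transport (τρ⟺ φ) (hyp refl) , IL.transport⁻ (τρ⟺ φ) (hyp refl))
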